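{- Let $G$ be a polygonal 2-tree and $T$ an arbitrary spanning tree of $G$. Let $C$ be the fundamental cycle of $T$ formed by a non-tree edge $(x,y)$. Let $C_1$ be an induced cycle containing $(x,y)$ in $\mathrm{Enc}(C)$, and let $C_2$ be another induced cycle of $G$ containing $(x,y)$. Then (a) $V(C) \cap V(C_2) = \{x,y\}$; and (b) for any vertices $u \in V(C)\setminus\{x,y\}$ and $v \in V(C_2)\setminus\{x,y\}$, every path joining $u$ and $v$ in $G$ passes through $x$ or $y$.
   Context: All graphs are finite, simple, undirected and unweighted. A polygonal 2-tree is defined recursively: every cycle is a polygonal 2-tree; if $G$ is a polygonal 2-tree and $(u,v) \in E(G)$, then adding a new path $P$ between $u$ and $v$ with $E(G) \cap E(P) = \emptyset$, $V(G) \cap V(P) = \{u,v\}$ and $|E(P)| \geq 2$ yields a polygonal 2-tree. An induced cycle is a chordless cycle. For a spanning tree $T$ and a non-tree edge $(x,y)$, the fundamental cycle of $(x,y)$ is the cycle formed by $(x,y)$ and the $x$–$y$ path in $T$. For a cycle $C$ in $G$, $\mathrm{Enc}(C)$ is the induced subgraph $G[V(C)]$. -}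

module Defs where

open import Data.Nat using (ℕ; _≤_)
open import Data.List using (List; []; _∷_; _++_; length; take; head; last)
open import Data.Maybe using (just)
open import Data.List.Membership.Propositional using (_∈_; _∉_)
open import Data.List.Relation.Unary.All using (All)
open import Data.List.Relation.Unary.Unique.Propositional using (Unique)
open import Data.Product using (Σ; ∃; ∃-syntax; _×_; _,_)
open import Data.Sum using (_⊎_)
open import Data.Empty using (⊥)
open import Relation.Nullary using (¬_)
open import Relation.Binary.PropositionalEquality using (_≡_)
open import Function.Bundles using (_⇔_)

-- Finite simple undirected graphs with vertices labelled by ℕ.
-- The vertex set is the (finite) set of members of the list V.

record Graph : Set₁ where
  field
    V      : List ℕ
    Adj    : ℕ → ℕ → Set
    sym    : ∀ {a b} → Adj a b → Adj b a
    irrefl : ∀ {a} → ¬ Adj a a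
    closed : ∀ {a b} → Adj a b → a ∈ V
open Graph public

Induced : (G : Graph) → List ℕ → Graph
Induced G S = record
  { V      = S
  ; Adj    = λ a b → Adj G a b × a ∈ S × b ∈ S
  ; sym    = λ { (e , p , q) → sym G e , q , p }
  ; irrefl = λ { (e , _ , _) → irrefl G e }
  ; closed = λ { (_ , p , _) → p }
  }

data Consec : List ℕ → ℕ → ℕ → Set where
  here  : ∀ {a b rest} → Consec (a ∷ b ∷ rest) a b
  there : ∀ {c rest a b} → Consec rest a b → Consec (c ∷ rest) a b

PathEdge : List ℕ → ℕ → ℕ → Set
PathEdge ps a b = Consec ps a b ⊎ Consec ps b a

-- edge relation of the cycle through the list cs (closing last → first)
CycEdge : List ℕ → ℕ → ℕ → Set
CycEdge cs a b = PathEdge (cs ++ take 1 cs) a b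

IsPath : Graph → List ℕ → Set
IsPath G ps = (1 ≤ length ps) × Unique ps × All (_∈ V G) ps
            × (∀ {a b} → Consec ps a b → Adj G a b)

IsPathFromTo : Graph → ℕ → ℕ → List ℕ → Set
IsPathFromTo G u v ps = IsPath G ps × head ps ≡ just u × last ps ≡ just v

IsCycle : Graph → List ℕ → Set
IsCycle G cs = (3 ≤ length cs) × Unique cs × All (_∈ V G) cs
             × (∀ {a b} → CycEdge cs a b → Adj G a b)

IsInducedCycle : Graph → List ℕ → Set
IsInducedCycle G cs = IsCycle G cs
  × (∀ {a b} → a ∈ cs → b ∈ cs → Adj G a b → CycEdge cs a b)

Enc : Graph → List ℕ → Graph
Enc G cs = Induced G cs

Connected : Graph → Set
Connected G = ∀ {a b} → a ∈ V G → b ∈ V G → ∃[ ps ] IsPathFromTo G a b ps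

Acyclic : Graph → Set
Acyclic G = ∀ cs → ¬ IsCycle G cs

IsSpanningTree : Graph → Graph → Set
IsSpanningTree G T = (∀ z → (z ∈ V T) ⇔ (z ∈ V G))
  × (∀ {a b} → Adj T a b → Adj G a b)
  × Connected T × Acyclic T

-- C (vertex sequence) is the fundamental cycle of the non-tree edge (x,y)
-- w.r.t. T: the x–y path in T, closed up by the edge (y,x).
IsFundamentalCycle : Graph → Graph → ℕ → ℕ → List ℕ → Set
IsFundamentalCycle G T x y cs =
  Adj G x y × ¬ Adj T x y × IsPathFromTo T x y cs

IsCycleGraph : Graph → Set
IsCycleGraph G = ∃[ cs ] ((3 ≤ length cs) × Unique cs
  × (∀ z → (z ∈ V G) ⇔ (z ∈ cs))
  × (∀ a b → Adj G a b ⇔ CycEdge cs a b))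

data Polygonal2Tree : Graph → Set₁ where
  cycle : ∀ {G} → IsCycleGraph G → Polygonal2Tree G
  addPath : ∀ {H G} → Polygonal2Tree H →
    (u v : ℕ) → Adj H u v →
    -- internal vertices ws of the new path P = u, ws, v (so |E(P)| ≥ 2)
    (ws : List ℕ) → 1 ≤ length ws → Unique ws → All (_∉ V H) ws →
    (∀ z → (z ∈ V G) ⇔ (z ∈ V H ⊎ z ∈ ws)) →
    (∀ a b → Adj G a b ⇔ (Adj H a b ⊎ PathEdge (u ∷ ws ++ v ∷ []) a b)) →
    Polygonal2Tree G

-- Induction on the polygonal 2-tree shows that two induced cycles through distinct vertices
-- x and y that are joined by a walk avoiding x and y have the same vertex set. In a single
-- cycle every cycle is the whole graph. When a path P = u, ws, v is glued onto an edge uv of H,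
-- an induced cycle of G either lies in H or meets ws; in the latter case it is forced, since
-- the vertices of ws have degree two, to be the cycle P + uv. A walk in G between vertices of H
-- can be shortened to a walk in H, replacing each excursion into ws by the edge uv; and if only
-- one of the two cycles is P + uv then {x, y} = {u, v}, which cuts ws off from H.
-- For the lemma, the vertices of the tree path C other than x and y are joined through that
-- path, and the induced cycle C₁ ⊆ C has such a vertex; so a vertex of C₂ outside {x, y} that
-- lies on C, or is joined to C outside {x, y}, would force C₁ and C₂ to coincide.
module Submission where

open import Defs
open import Level using (0ℓ)
open import Data.Nat using (ℕ; _≤_; s≤s; _≟_)
open import Data.Nat.Properties using (m≤n+m)
open import Data.List using (List; []; _∷_; _++_; _∷ʳ_; length; take; head; last; initLast; _∷ʳ′_)
open import Data.List.Properties using (++-assoc; ++-identityʳ; length-++)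
open import Data.Maybe using (just)
open import Data.Maybe.Properties using (just-injective)
open import Data.List.Membership.Propositional using (_∈_; _∉_)
open import Data.List.Membership.Propositional.Properties using (∈-++⁻; ∈-++⁺ˡ; ∈-∃++)
open import Data.List.Membership.DecPropositional _≟_ using (_∈?_)
open import Data.List.Relation.Unary.Any using (here; there)
open import Data.List.Relation.Unary.Any.Properties using (singleton⁻)
open import Data.List.Relation.Unary.All as All using (All; []; _∷_)
open import Data.List.Relation.Unary.All.Properties using (¬Any⇒All¬)
open import Data.List.Relation.Unary.AllPairs as AllPairs using ([]; _∷_)
open import Data.List.Relation.Unary.Unique.Propositional using (Unique)
open import Data.List.Relation.Unary.Unique.Propositional.Properties using (Unique[x∷xs]⇒x∉xs; ++⁺)
open import Data.List.Relation.Binary.Subset.Propositional using (_⊆_)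
open import Data.List.Relation.Binary.Permutation.Propositional using (_↭_; ↭-sym; ↭⇒↭ₛ)
open import Data.List.Relation.Binary.Permutation.Propositional.Properties using (↭-length; ++-comm; ∷↭∷ʳ)
import Data.List.Relation.Binary.Permutation.Setoid.Properties as PermutationSetoid
open import Data.Product using (∃; _×_; _,_; proj₁; proj₂)
open import Data.Sum using (_⊎_; inj₁; inj₂)
import Data.Sum as Sum
open import Data.Empty using (⊥-elim)
open import Relation.Nullary using (¬_; Dec; yes; no)
open import Relation.Binary.Core using (Rel; _⇒_)
open import Relation.Binary.PropositionalEquality
  using (_≡_; refl; subst; cong; setoid) renaming (sym to ≡-sym; trans to ≡-trans)
open import Relation.Binary.Construct.Closure.ReflexiveTransitive as Star
  using (Star; ε; _◅_; _◅◅_)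
open import Function using (id; _∘′_)
open import Function.Bundles using (_⇔_; Equivalence; mk⇔)
open Equivalence using (to; from)

open PermutationSetoid (setoid ℕ) using (Unique-resp-↭)

private
  variable
    a b c p q w w₁ w₂ x y z : ℕ
    l m cs C C₁ C₂ D : List ℕ
    G H : Graph

consec-∈ˡ : Consec l a b → a ∈ l
consec-∈ˡ here      = here refl
consec-∈ˡ (there k) = there (consec-∈ˡ k)

consec-∈ʳ : Consec l a b → b ∈ l
consec-∈ʳ here      = there (here refl)
consec-∈ʳ (there k) = there (consec-∈ʳ k)

consec-++⁺ : (m : List ℕ) → Consec l a b → Consec (l ++ m) a b
consec-++⁺ m here      = here
consec-++⁺ m (there k) = there (consec-++⁺ m k)

consec-∷ʳ⁻ : (l : List ℕ) → Consec (l ∷ʳ z) a b → Consec l a b ⊎ (last l ≡ just a × b ≡ z)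
consec-∷ʳ⁻ []            (there ())
consec-∷ʳ⁻ (c ∷ [])      here              = inj₂ (refl , refl)
consec-∷ʳ⁻ (c ∷ [])      (there (there ()))
consec-∷ʳ⁻ (c ∷ d ∷ l)   here              = inj₁ here
consec-∷ʳ⁻ (c ∷ d ∷ l)   (there k)         = Sum.map₁ there (consec-∷ʳ⁻ (d ∷ l) k)

consec-∷ʳ⁺ : (l : List ℕ) → last l ≡ just a → Consec (l ∷ʳ z) a z
consec-∷ʳ⁺ (c ∷ [])    refl = here
consec-∷ʳ⁺ (c ∷ d ∷ l) e    = there (consec-∷ʳ⁺ (d ∷ l) e)

last-∈ : (l : List ℕ) → last l ≡ just a → a ∈ l
last-∈ (c ∷ [])    refl = here refl
last-∈ (c ∷ d ∷ l) e    = there (last-∈ (d ∷ l) e)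

last-∷ʳ : (l : List ℕ) → last (l ∷ʳ z) ≡ just z
last-∷ʳ []          = refl
last-∷ʳ (c ∷ [])    = refl
last-∷ʳ (c ∷ d ∷ l) = last-∷ʳ (d ∷ l)

last-∷ : (c : ℕ) (l : List ℕ) → ∃ λ t → last (c ∷ l) ≡ just t
last-∷ c []      = c , refl
last-∷ c (d ∷ l) = last-∷ d l

head-∈ : (l : List ℕ) → head l ≡ just a → a ∈ l
head-∈ (c ∷ l) refl = here refl

pathEdge-∈ˡ : PathEdge l a b → a ∈ l
pathEdge-∈ˡ = Sum.[ consec-∈ˡ , consec-∈ʳ ]

pathEdge-∈ʳ : PathEdge l a b → b ∈ l
pathEdge-∈ʳ = Sum.[ consec-∈ʳ , consec-∈ˡ ]

pathEdge⇒cycEdge : PathEdge cs ⇒ CycEdge cs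
pathEdge⇒cycEdge {cs} = Sum.map (consec-++⁺ (take 1 cs)) (consec-++⁺ (take 1 cs))

pathEdge-adj : (∀ {a b} → Consec l a b → Adj G a b) → PathEdge l ⇒ Adj G
pathEdge-adj {G = G} adj = Sum.[ adj , sym G ∘′ adj ]

take-1-⊆ : (cs : List ℕ) → take 1 cs ⊆ cs
take-1-⊆ (c ∷ cs) (here e) = here e

cycEdge-∈ˡ : CycEdge cs a b → a ∈ cs
cycEdge-∈ˡ {cs} e = Sum.[ id , take-1-⊆ cs ] (∈-++⁻ cs (pathEdge-∈ˡ e))

cycEdge-∈ʳ : CycEdge cs a b → b ∈ cs
cycEdge-∈ʳ {cs} e = Sum.[ id , take-1-⊆ cs ] (∈-++⁻ cs (pathEdge-∈ʳ e))

Unique-∷ʳ : Unique l → z ∉ l → Unique (l ∷ʳ z)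
Unique-∷ʳ u z∉l = ++⁺ u ([] ∷ []) λ { (k , here refl) → z∉l k }

Unique-∷ʳ⇒∉ : (l : List ℕ) → Unique (l ∷ʳ z) → z ∉ l
Unique-∷ʳ⇒∉ {z} l u = Unique[x∷xs]⇒x∉xs (Unique-resp-↭ (↭⇒↭ₛ (↭-sym (∷↭∷ʳ z l))) u)

cycEdge-rotate₁ : (c : ℕ) (l : List ℕ) → CycEdge (c ∷ l) ⇒ CycEdge (l ∷ʳ c)
cycEdge-rotate₁ c []      e = e
cycEdge-rotate₁ c (d ∷ l) = Sum.map move move
  where
  move : Consec (c ∷ d ∷ l ∷ʳ c) ⇒ Consec ((d ∷ l ∷ʳ c) ∷ʳ d)
  move here      = consec-∷ʳ⁺ (d ∷ l ∷ʳ c) (last-∷ʳ (d ∷ l))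
  move (there k) = consec-++⁺ (d ∷ []) k

cycEdge-unrotate₁ : (c : ℕ) (l : List ℕ) → CycEdge (l ∷ʳ c) ⇒ CycEdge (c ∷ l)
cycEdge-unrotate₁ c []      e = e
cycEdge-unrotate₁ c (d ∷ l) = Sum.map move move
  where
  move : Consec ((d ∷ l ∷ʳ c) ∷ʳ d) ⇒ Consec (c ∷ d ∷ l ∷ʳ c)
  move k with consec-∷ʳ⁻ (d ∷ l ∷ʳ c) k
  ... | inj₁ k′           = there k′
  ... | inj₂ (e , refl) with just-injective (≡-trans (≡-sym e) (last-∷ʳ (d ∷ l)))
  ...   | refl = here

cycEdge-≡ : l ≡ m → CycEdge l ⇒ CycEdge m
cycEdge-≡ refl e = e

cycEdge-rotate : (l : List ℕ) (a : ℕ) (m : List ℕ) →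
  (CycEdge (l ++ a ∷ m) ⇒ CycEdge (a ∷ m ++ l)) × (CycEdge (a ∷ m ++ l) ⇒ CycEdge (l ++ a ∷ m))
cycEdge-rotate []      a m = cycEdge-≡ (cong (a ∷_) (≡-sym (++-identityʳ m)))
                           , cycEdge-≡ (cong (a ∷_) (++-identityʳ m))
cycEdge-rotate (c ∷ l) a m =
    (λ e → cycEdge-≡ (cong (a ∷_) (++-assoc m (c ∷ []) l))
             (proj₁ ih (cycEdge-≡ (++-assoc l (a ∷ m) (c ∷ [])) (cycEdge-rotate₁ c (l ++ a ∷ m) e))))
  , (λ e → cycEdge-unrotate₁ c (l ++ a ∷ m) (cycEdge-≡ (≡-sym (++-assoc l (a ∷ m) (c ∷ [])))
             (proj₂ ih (cycEdge-≡ (≡-sym (cong (a ∷_) (++-assoc m (c ∷ []) l))) e))))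
  where
  ih : (CycEdge (l ++ a ∷ m ∷ʳ c) ⇒ CycEdge (a ∷ (m ∷ʳ c) ++ l))
     × (CycEdge (a ∷ (m ∷ʳ c) ++ l) ⇒ CycEdge (l ++ a ∷ m ∷ʳ c))
  ih = cycEdge-rotate l a (m ∷ʳ c)

record CycleNeighbours (cs : List ℕ) (a : ℕ) : Set where
  field
    left right  : ℕ
    left≢right  : ¬ left ≡ right
    edgeˡ       : CycEdge cs a left
    edgeʳ       : CycEdge cs a right
    only        : ∀ {b} → CycEdge cs a b → b ≡ left ⊎ b ≡ right

cycleNeighbours-head : (a : ℕ) (l : List ℕ) → Unique (a ∷ l) → 2 ≤ length l → CycleNeighbours (a ∷ l) a
cycleNeighbours-head a (s ∷ []) u (s≤s ())
cycleNeighbours-head a (s ∷ d ∷ r) u _ with last-∷ d r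
... | t , last≡t = record
  { left = s ; right = t ; left≢right = s≢t
  ; edgeˡ = inj₁ here
  ; edgeʳ = inj₂ (there (consec-∷ʳ⁺ (s ∷ d ∷ r) last≡t))
  ; only = only }
  where
  a∉ : a ∉ s ∷ d ∷ r
  a∉ = Unique[x∷xs]⇒x∉xs u
  s≢t : ¬ s ≡ t
  s≢t refl = Unique[x∷xs]⇒x∉xs (AllPairs.tail u) (last-∈ (d ∷ r) last≡t)
  only : ∀ {b} → CycEdge (a ∷ s ∷ d ∷ r) a b → b ≡ s ⊎ b ≡ t
  only (inj₁ here) = inj₁ refl
  only (inj₁ (there k)) with consec-∷ʳ⁻ (s ∷ d ∷ r) k
  ... | inj₁ k′      = ⊥-elim (a∉ (consec-∈ˡ k′))
  ... | inj₂ (e , _) = ⊥-elim (a∉ (last-∈ (s ∷ d ∷ r) e))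
  only (inj₂ here) = ⊥-elim (a∉ (here refl))
  only (inj₂ (there k)) with consec-∷ʳ⁻ (s ∷ d ∷ r) k
  ... | inj₁ k′      = ⊥-elim (a∉ (consec-∈ʳ k′))
  ... | inj₂ (e , _) = inj₂ (just-injective (≡-trans (≡-sym e) last≡t))

cycleNeighbours : Unique cs → 3 ≤ length cs → a ∈ cs → CycleNeighbours cs a
cycleNeighbours {a = a} u len a∈cs with ∈-∃++ a∈cs
... | l , m , refl = record
  { left = left ; right = right ; left≢right = left≢right
  ; edgeˡ = unrotate edgeˡ ; edgeʳ = unrotate edgeʳ
  ; only = λ e → only (rotate e) }
  where
  rotation : l ++ a ∷ m ↭ a ∷ m ++ l
  rotation = ++-comm l (a ∷ m)
  len′ : 2 ≤ length (m ++ l)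
  len′ with subst (3 ≤_) (↭-length rotation) len
  ... | s≤s h = h
  rotate : CycEdge (l ++ a ∷ m) ⇒ CycEdge (a ∷ m ++ l)
  rotate = proj₁ (cycEdge-rotate l a m)
  unrotate : CycEdge (a ∷ m ++ l) ⇒ CycEdge (l ++ a ∷ m)
  unrotate = proj₂ (cycEdge-rotate l a m)
  open CycleNeighbours (cycleNeighbours-head a (m ++ l) (Unique-resp-↭ (↭⇒↭ₛ rotation) u) len′)

spread : {Q : ℕ → Set} (l : List ℕ) → (∀ {a b} → PathEdge l a b → Q a → Q b) →
  w ∈ l → Q w → All Q l
spread (c ∷ [])    closed (here refl) q = q ∷ []
spread (c ∷ d ∷ l) closed (here refl) q =
  q ∷ spread (d ∷ l) (closed ∘′ Sum.map there there) (here refl) (closed (inj₁ here) q)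
spread (c ∷ d ∷ l) closed (there w∈) q with spread (d ∷ l) (closed ∘′ Sum.map there there) w∈ q
... | qs@(q′ ∷ _) = closed (inj₂ here) q′ ∷ qs

distinct-pair-covers : ¬ p ≡ q → (p ≡ a ⊎ p ≡ b) → (q ≡ a ⊎ q ≡ b) → (c ≡ a ⊎ c ≡ b) → c ≡ p ⊎ c ≡ q
distinct-pair-covers p≢q (inj₁ refl) (inj₁ refl) _          = ⊥-elim (p≢q refl)
distinct-pair-covers p≢q (inj₂ refl) (inj₂ refl) _          = ⊥-elim (p≢q refl)
distinct-pair-covers p≢q (inj₁ refl) (inj₂ refl) c∈         = c∈
distinct-pair-covers p≢q (inj₂ refl) (inj₁ refl) c∈         = Sum.swap c∈

neighbour∈cycle : {E : Rel ℕ 0ℓ} → Unique D → 3 ≤ length D → CycEdge D ⇒ E → a ∈ D →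
  (∀ {b} → E a b → b ≡ p ⊎ b ≡ q) → E a b → b ∈ D
neighbour∈cycle {D = D} {b = b} uD lenD D⇒E a∈D deg e =
  Sum.[ (λ b≡left → subst (_∈ D) (≡-sym b≡left) (cycEdge-∈ʳ edgeˡ))
      , (λ b≡right → subst (_∈ D) (≡-sym b≡right) (cycEdge-∈ʳ edgeʳ)) ]
    (distinct-pair-covers left≢right (deg (D⇒E edgeˡ)) (deg (D⇒E edgeʳ)) (deg e))
  where open CycleNeighbours (cycleNeighbours uD lenD a∈D)

subcycle-spans : Unique cs → 3 ≤ length cs → Unique D → 3 ≤ length D →
  CycEdge D ⇒ CycEdge cs → cs ⊆ D
subcycle-spans {cs} {D@(d ∷ _)} ucs lencs uD lenD D⇒cs =
  All.lookup (spread cs onward (D⊆cs (here refl)) (here refl))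
  where
  D⊆cs : D ⊆ cs
  D⊆cs a∈D = cycEdge-∈ˡ (D⇒cs (CycleNeighbours.edgeˡ (cycleNeighbours uD lenD a∈D)))
  onward : ∀ {a b} → PathEdge cs a b → a ∈ D → b ∈ D
  onward e a∈D = neighbour∈cycle uD lenD D⇒cs a∈D
    (CycleNeighbours.only (cycleNeighbours ucs lencs (D⊆cs a∈D))) (pathEdge⇒cycEdge e)

Avoids : ℕ → ℕ → ℕ → Set
Avoids x y z = ¬ z ≡ x × ¬ z ≡ y

record AvoidingEdge (G : Graph) (x y a b : ℕ) : Set where
  constructor avoidingEdge
  field
    adj     : Adj G a b
    avoidsˡ : Avoids x y a
    avoidsʳ : Avoids x y b

Linked : Graph → ℕ → ℕ → Rel ℕ 0ℓ
Linked G x y = Star (AvoidingEdge G x y)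

linked-sym : Linked G x y a b → Linked G x y b a
linked-sym {G} = Star.reverse λ (avoidingEdge e aA bA) → avoidingEdge (sym G e) bA aA

linked-mono : (∀ {a b} → Adj G a b → Adj H a b) → Linked G x y ⇒ Linked H x y
linked-mono G⊆H = Star.map λ (avoidingEdge e aA bA) → avoidingEdge (G⊆H e) aA bA

path⇒linked : PathEdge l ⇒ Adj G → All (Avoids x y) l → a ∈ l → b ∈ l → Linked G x y a b
path⇒linked {l = l} {G = G} {x = x} {y = y} {a = a} adj avoids a∈l =
  All.lookup (spread l extend a∈l ε)
  where
  extend : ∀ {b c} → PathEdge l b c → Linked G x y a b → Linked G x y a c
  extend e walk =
    walk ◅◅ avoidingEdge (adj e) (All.lookup avoids (pathEdge-∈ˡ e)) (All.lookup avoids (pathEdge-∈ʳ e)) ◅ ε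

LinkedInducedCyclesCoincide : Graph → Set
LinkedInducedCyclesCoincide G = ∀ {x y} → ¬ x ≡ y → ∀ {C₁ C₂} →
  IsInducedCycle G C₁ → IsInducedCycle G C₂ →
  x ∈ C₁ → y ∈ C₁ → x ∈ C₂ → y ∈ C₂ →
  ∀ {w₁ w₂} → w₁ ∈ C₁ → Avoids x y w₁ → w₂ ∈ C₂ → Avoids x y w₂ →
  Linked G x y w₁ w₂ → C₁ ⊆ C₂ × C₂ ⊆ C₁

inducedCycle-⊆V : IsInducedCycle G C → All (_∈ V G) C
inducedCycle-⊆V ((_ , _ , vertices , _) , _) = vertices

cycleGraph-cycle-spans : ((cs , _) : IsCycleGraph G) → IsCycle G C → C ⊆ cs × cs ⊆ C
cycleGraph-cycle-spans (cs , lencs , ucs , vertices , edges) (lenC , uC , C⊆G , adjC) =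
    (λ z∈C → to (vertices _) (All.lookup C⊆G z∈C))
  , subcycle-spans ucs lencs uC lenC (λ e → to (edges _ _) (adjC e))

cycleGraph-coincide : IsCycleGraph G → LinkedInducedCyclesCoincide G
cycleGraph-coincide {G} cycleGraph _ (ic₁ , _) (ic₂ , _) _ _ _ _ _ _ _ _ _
  with cycleGraph-cycle-spans {G} cycleGraph ic₁ | cycleGraph-cycle-spans {G} cycleGraph ic₂
... | C₁⊆ , C₁⊇ | C₂⊆ , C₂⊇ = (λ z∈C₁ → C₂⊇ (C₁⊆ z∈C₁)) , (λ z∈C₂ → C₁⊇ (C₂⊆ z∈C₂))

pathEdge-meets-interior : (u : ℕ) (ws : List ℕ) (v : ℕ) → 1 ≤ length ws →
  PathEdge (u ∷ ws ∷ʳ v) a b → a ∈ ws ⊎ b ∈ ws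
pathEdge-meets-interior u (h ∷ t) v _ (inj₁ here)      = inj₂ (here refl)
pathEdge-meets-interior u (h ∷ t) v _ (inj₂ here)      = inj₁ (here refl)
pathEdge-meets-interior u (h ∷ t) v _ (inj₁ (there k)) with consec-∷ʳ⁻ (h ∷ t) k
... | inj₁ k′      = inj₁ (consec-∈ˡ k′)
... | inj₂ (e , _) = inj₁ (last-∈ (h ∷ t) e)
pathEdge-meets-interior u (h ∷ t) v _ (inj₂ (there k)) with consec-∷ʳ⁻ (h ∷ t) k
... | inj₁ k′      = inj₂ (consec-∈ˡ k′)
... | inj₂ (e , _) = inj₂ (last-∈ (h ∷ t) e)

∈path⇒near-interior : (u : ℕ) (ws : List ℕ) (v : ℕ) → 1 ≤ length ws → z ∈ u ∷ ws ∷ʳ v →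
  z ∈ ws ⊎ ∃ λ w → w ∈ ws × PathEdge (u ∷ ws ∷ʳ v) w z
∈path⇒near-interior u (h ∷ t) v _ (here refl) = inj₂ (h , here refl , inj₂ here)
∈path⇒near-interior u (h ∷ t) v _ (there z∈) with ∈-++⁻ (h ∷ t) z∈
... | inj₁ z∈ws        = inj₁ z∈ws
... | inj₂ (here refl) with last-∷ h t
...   | l , last≡l = inj₂ (l , last-∈ (h ∷ t) last≡l , inj₁ (there (consec-∷ʳ⁺ (h ∷ t) last≡l)))

path-length : (u : ℕ) (ws : List ℕ) (v : ℕ) → 1 ≤ length ws → 3 ≤ length (u ∷ ws ∷ʳ v)
path-length u (h ∷ t) v _ rewrite length-++ t {v ∷ []} = s≤s (s≤s (m≤n+m 1 (length t)))

module PathAddition {H G : Graph} (u v : ℕ) (uv : Adj H u v) (ws : List ℕ)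
  (ws-nonempty : 1 ≤ length ws) (ws-unique : Unique ws) (ws-new : All (_∉ V H) ws)
  (vertices : ∀ z → (z ∈ V G) ⇔ (z ∈ V H ⊎ z ∈ ws))
  (edges : ∀ a b → Adj G a b ⇔ (Adj H a b ⊎ PathEdge (u ∷ ws ++ v ∷ []) a b)) where

  P : List ℕ
  P = u ∷ ws ∷ʳ v

  IsEnd : ℕ → Set
  IsEnd z = z ≡ u ⊎ z ≡ v

  vertex-G : z ∈ V G → z ∈ V H ⊎ z ∈ ws
  vertex-G = to (vertices _)

  ws∉H : z ∈ ws → z ∉ V H
  ws∉H = All.lookup ws-new

  edge-G : Adj G a b → Adj H a b ⊎ PathEdge P a b
  edge-G = to (edges _ _)

  H⇒G : Adj H ⇒ Adj G
  H⇒G e = from (edges _ _) (inj₁ e)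

  P⇒G : PathEdge P ⇒ Adj G
  P⇒G e = from (edges _ _) (inj₂ e)

  ∈P : z ∈ P → z ∈ ws ⊎ IsEnd z
  ∈P (here refl) = inj₂ (inj₁ refl)
  ∈P (there z∈) with ∈-++⁻ ws z∈
  ... | inj₁ z∈ws        = inj₁ z∈ws
  ... | inj₂ (here refl) = inj₂ (inj₂ refl)

  interior⇒P : PathEdge ws ⇒ PathEdge P
  interior⇒P = Sum.map (there ∘′ consec-++⁺ (v ∷ [])) (there ∘′ consec-++⁺ (v ∷ []))

  cycEdge-P⇒adj : CycEdge P ⇒ Adj G
  cycEdge-P⇒adj (inj₁ k) with consec-∷ʳ⁻ P k
  ... | inj₁ k′ = P⇒G (inj₁ k′)
  ... | inj₂ (e , refl) with just-injective (≡-trans (≡-sym e) (last-∷ʳ (u ∷ ws)))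
  ...   | refl = H⇒G (sym H uv)
  cycEdge-P⇒adj (inj₂ k) = sym G (cycEdge-P⇒adj (inj₁ k))

  P-unique : Unique P
  P-unique = ¬Any⇒All¬ (ws ∷ʳ v) u∉ ∷ Unique-∷ʳ ws-unique (λ v∈ws → ws∉H v∈ws (closed H (sym H uv)))
    where
    u∉ : u ∉ ws ∷ʳ v
    u∉ u∈ with ∈-++⁻ ws u∈
    ... | inj₁ u∈ws        = ws∉H u∈ws (closed H uv)
    ... | inj₂ (here refl) = irrefl H uv

  P-length : 3 ≤ length P
  P-length = path-length u ws v ws-nonempty

  adj-H : a ∈ V H → b ∈ V H → Adj G a b → Adj H a b
  adj-H a∈H b∈H e with edge-G e
  ... | inj₁ e′ = e′
  ... | inj₂ e′ with pathEdge-meets-interior u ws v ws-nonempty e′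
  ...   | inj₁ a∈ws = ⊥-elim (ws∉H a∈ws a∈H)
  ...   | inj₂ b∈ws = ⊥-elim (ws∉H b∈ws b∈H)

  ws-adj⇒cycEdge : a ∈ ws → Adj G a b → CycEdge P a b
  ws-adj⇒cycEdge a∈ws e with edge-G e
  ... | inj₁ e′ = ⊥-elim (ws∉H a∈ws (closed H e′))
  ... | inj₂ e′ = pathEdge⇒cycEdge e′

  ws-adj-H : a ∈ ws → Adj G a b → b ∈ V H → IsEnd b
  ws-adj-H a∈ws e b∈H with ∈P (cycEdge-∈ʳ (ws-adj⇒cycEdge a∈ws e))
  ... | inj₁ b∈ws = ⊥-elim (ws∉H b∈ws b∈H)
  ... | inj₂ end  = end

  in-H-or-meets-ws : All (_∈ V G) C → All (_∈ V H) C ⊎ ∃ λ w → w ∈ C × w ∈ ws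
  in-H-or-meets-ws []           = inj₁ []
  in-H-or-meets-ws (z∈G ∷ C⊆G) with vertex-G z∈G | in-H-or-meets-ws C⊆G
  ... | inj₂ z∈ws | _                   = inj₂ (_ , here refl , z∈ws)
  ... | inj₁ z∈H  | inj₁ C⊆H            = inj₁ (z∈H ∷ C⊆H)
  ... | inj₁ _    | inj₂ (w , w∈C , w∈ws) = inj₂ (w , there w∈C , w∈ws)

  inducedCycle-H : All (_∈ V H) C → IsInducedCycle G C → IsInducedCycle H C
  inducedCycle-H C⊆H ((lenC , uC , _ , adjC) , chordless) =
      (lenC , uC , C⊆H , λ e → adj-H (All.lookup C⊆H (cycEdge-∈ˡ e)) (All.lookup C⊆H (cycEdge-∈ʳ e)) (adjC e))
    , λ a∈C b∈C e → chordless a∈C b∈C (H⇒G e)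

  -- The vertices of ws have degree two in G, so a chordless cycle through one of them runs along P.
  meets-ws⇒≈P : IsInducedCycle G C → w ∈ C → w ∈ ws → C ⊆ P × P ⊆ C
  meets-ws⇒≈P {C} ((lenC , uC , _ , adjC) , chordless) w∈C w∈ws = C⊆P , P⊆C
    where
    continue : a ∈ C → a ∈ ws → Adj G a b → b ∈ C
    continue a∈C a∈ws = neighbour∈cycle uC lenC adjC a∈C
      (CycleNeighbours.only (cycleNeighbours P-unique P-length (there (∈-++⁺ˡ a∈ws))) ∘′ ws-adj⇒cycEdge a∈ws)
    ws⊆C : ws ⊆ C
    ws⊆C = All.lookup (spread ws (λ e a∈C → continue a∈C (pathEdge-∈ˡ e) (P⇒G (interior⇒P e))) w∈ws w∈C)
    P⊆C : P ⊆ C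
    P⊆C z∈P with ∈path⇒near-interior u ws v ws-nonempty z∈P
    ... | inj₁ z∈ws            = ws⊆C z∈ws
    ... | inj₂ (_ , w∈ws , e) = continue (ws⊆C w∈ws) w∈ws (P⇒G e)
    C⊆P : C ⊆ P
    C⊆P = subcycle-spans uC lenC P-unique P-length
      λ e → chordless (P⊆C (cycEdge-∈ˡ e)) (P⊆C (cycEdge-∈ʳ e)) (cycEdge-P⇒adj e)

  ends-linked : IsEnd a → IsEnd b → Avoids x y a → Avoids x y b → Linked H x y a b
  ends-linked (inj₁ refl) (inj₁ refl) _  _  = ε
  ends-linked (inj₁ refl) (inj₂ refl) aA bA = avoidingEdge uv aA bA ◅ ε
  ends-linked (inj₂ refl) (inj₁ refl) aA bA = avoidingEdge (sym H uv) aA bA ◅ ε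
  ends-linked (inj₂ refl) (inj₂ refl) _  _  = ε

  -- While a walk from a runs through ws, H still reaches every end of P it could leave by.
  Trace : ℕ → ℕ → ℕ → ℕ → Set
  Trace x y a c = (c ∈ V H → Linked H x y a c)
                × (c ∈ ws → ∀ {e} → IsEnd e → Avoids x y e → Linked H x y a e)

  trace-step : Trace x y a b → AvoidingEdge G x y b c → Trace x y a c
  trace-step (toH , toEnds) (avoidingEdge bc bA cA) with vertex-G (closed G bc)
  ... | inj₁ b∈H  = (λ c∈H → toH b∈H ◅◅ avoidingEdge (adj-H b∈H c∈H bc) bA cA ◅ ε)
                  , (λ c∈ws end eA → toH b∈H ◅◅ ends-linked (ws-adj-H c∈ws (sym G bc) b∈H) end bA eA)
  ... | inj₂ b∈ws = (λ c∈H → toEnds b∈ws (ws-adj-H b∈ws bc c∈H) cA) , (λ _ → toEnds b∈ws)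

  linked-H : a ∈ V H → Linked G x y a c → c ∈ V H → Linked H x y a c
  linked-H {x = x} {y = y} a∈H walk = proj₁ (Star.foldl (λ a c → a ∈ V H → Trace x y a c)
    (λ trace e a∈H → trace-step (trace a∈H) e)
    (λ a∈H → (λ _ → ε) , λ a∈ws → ⊥-elim (ws∉H a∈ws a∈H))
    walk a∈H)

  ends-block : ¬ x ≡ y → IsEnd x → IsEnd y → Avoids x y z → ¬ IsEnd z
  ends-block x≢y (inj₁ refl) (inj₁ refl) _           _ = x≢y refl
  ends-block x≢y (inj₂ refl) (inj₂ refl) _           _ = x≢y refl
  ends-block _   (inj₁ refl) (inj₂ refl) (z≢u , z≢v) = Sum.[ z≢u , z≢v ]
  ends-block _   (inj₂ refl) (inj₁ refl) (z≢v , z≢u) = Sum.[ z≢u , z≢v ]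

  walk-stays-in-ws : (∀ {z} → Avoids x y z → ¬ IsEnd z) → w ∈ ws → Linked G x y w c → c ∈ ws
  walk-stays-in-ws blocked w∈ws ε = w∈ws
  walk-stays-in-ws blocked w∈ws (avoidingEdge wb _ bA ◅ walk) with vertex-G (closed G (sym G wb))
  ... | inj₁ b∈H  = ⊥-elim (blocked bA (ws-adj-H w∈ws wb b∈H))
  ... | inj₂ b∈ws = walk-stays-in-ws blocked b∈ws walk

  -- x and y lie on both P and H, hence {x, y} = {u, v}, which separates ws from H.
  ≈P-unlinked-H : ¬ x ≡ y → C₁ ⊆ P → All (_∈ V H) C₂ →
    x ∈ C₁ → y ∈ C₁ → x ∈ C₂ → y ∈ C₂ →
    w₁ ∈ C₁ → Avoids x y w₁ → w₂ ∈ C₂ → ¬ Linked G x y w₁ w₂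
  ≈P-unlinked-H {x} {y} {C₁} {w₁ = w₁} x≢y C₁⊆P C₂⊆H x₁ y₁ x₂ y₂ w₁∈C₁ w₁A w₂∈C₂ walk =
    ws∉H (walk-stays-in-ws blocked w₁∈ws walk) (All.lookup C₂⊆H w₂∈C₂)
    where
    end : z ∈ C₁ → z ∈ V H → IsEnd z
    end z∈C₁ z∈H = Sum.[ (λ z∈ws → ⊥-elim (ws∉H z∈ws z∈H)) , id ] (∈P (C₁⊆P z∈C₁))
    blocked : Avoids x y z → ¬ IsEnd z
    blocked = ends-block x≢y (end x₁ (All.lookup C₂⊆H x₂)) (end y₁ (All.lookup C₂⊆H y₂))
    w₁∈ws : w₁ ∈ ws
    w₁∈ws = Sum.[ id , (λ e → ⊥-elim (blocked w₁A e)) ] (∈P (C₁⊆P w₁∈C₁))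

  coincide : LinkedInducedCyclesCoincide H → LinkedInducedCyclesCoincide G
  coincide coincideH x≢y ic₁ ic₂ x₁ y₁ x₂ y₂ w₁∈C₁ w₁A w₂∈C₂ w₂A walk
    with in-H-or-meets-ws (inducedCycle-⊆V {G} ic₁) | in-H-or-meets-ws (inducedCycle-⊆V {G} ic₂)
  ... | inj₁ C₁⊆H | inj₁ C₂⊆H =
    coincideH x≢y (inducedCycle-H C₁⊆H ic₁) (inducedCycle-H C₂⊆H ic₂) x₁ y₁ x₂ y₂ w₁∈C₁ w₁A w₂∈C₂ w₂A
      (linked-H (All.lookup C₁⊆H w₁∈C₁) walk (All.lookup C₂⊆H w₂∈C₂))
  ... | inj₂ (_ , w∈C₁ , w∈ws) | inj₂ (_ , w′∈C₂ , w′∈ws)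
    with meets-ws⇒≈P ic₁ w∈C₁ w∈ws | meets-ws⇒≈P ic₂ w′∈C₂ w′∈ws
  ...   | C₁⊆P , P⊆C₁ | C₂⊆P , P⊆C₂ = (λ z∈C₁ → P⊆C₂ (C₁⊆P z∈C₁)) , (λ z∈C₂ → P⊆C₁ (C₂⊆P z∈C₂))
  coincide _ x≢y ic₁ ic₂ x₁ y₁ x₂ y₂ w₁∈C₁ w₁A w₂∈C₂ w₂A walk
    | inj₂ (_ , w∈C₁ , w∈ws) | inj₁ C₂⊆H =
    ⊥-elim (≈P-unlinked-H x≢y (proj₁ (meets-ws⇒≈P ic₁ w∈C₁ w∈ws)) C₂⊆H x₁ y₁ x₂ y₂ w₁∈C₁ w₁A w₂∈C₂ walk)
  coincide _ x≢y ic₁ ic₂ x₁ y₁ x₂ y₂ w₁∈C₁ w₁A w₂∈C₂ w₂A walk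
    | inj₁ C₁⊆H | inj₂ (_ , w∈C₂ , w∈ws) =
    ⊥-elim (≈P-unlinked-H x≢y (proj₁ (meets-ws⇒≈P ic₂ w∈C₂ w∈ws)) C₁⊆H x₂ y₂ x₁ y₁ w₂∈C₂ w₂A w₁∈C₁
      (linked-sym walk))

polygonal2Tree-coincide : Polygonal2Tree G → LinkedInducedCyclesCoincide G
polygonal2Tree-coincide {G} (cycle cycleGraph) = cycleGraph-coincide {G} cycleGraph
polygonal2Tree-coincide {G} (addPath {H} tree u v uv ws nonempty unique new vertices edges) =
  PathAddition.coincide {H} {G} u v uv ws nonempty unique new vertices edges (polygonal2Tree-coincide tree)

induced-inducedCycle : (S : List ℕ) → S ⊆ V G →
  IsInducedCycle (Induced G S) C → IsInducedCycle G C × C ⊆ S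
induced-inducedCycle S S⊆G ((lenC , uC , C⊆S , adjC) , chordless) =
    ( (lenC , uC , All.map S⊆G C⊆S , proj₁ ∘′ adjC)
    , λ a∈C b∈C e → chordless a∈C b∈C (e , All.lookup C⊆S a∈C , All.lookup C⊆S b∈C))
  , All.lookup C⊆S

cycle-avoiding-vertex : IsCycle G C → x ∈ C → ∃ λ w → w ∈ C × Avoids x y w
cycle-avoiding-vertex {G} {C} {x} {y} (lenC , uC , _ , adjC) x∈C = pick (right ≟ y)
  where
  open CycleNeighbours (cycleNeighbours uC lenC x∈C)
  not-x : CycEdge C x z → ¬ z ≡ x
  not-x e z≡x = irrefl G (subst (Adj G x) z≡x (adjC e))
  pick : Dec (right ≡ y) → ∃ λ w → w ∈ C × Avoids x y w
  pick (no right≢y)  = right , cycEdge-∈ʳ edgeʳ , not-x edgeʳ , right≢y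
  pick (yes right≡y) =
    left , cycEdge-∈ʳ edgeˡ , not-x edgeˡ , λ left≡y → left≢right (≡-trans left≡y (≡-sym right≡y))

path-interior-linked : IsPathFromTo G x y C →
  a ∈ C → Avoids x y a → b ∈ C → Avoids x y b → Linked G x y a b
path-interior-linked {G} {C = c ∷ r} ((_ , uC , _ , adjC) , refl , lastC) a∈C aA b∈C bA with initLast r
... | [] = ⊥-elim (proj₁ aA (singleton⁻ a∈C))
... | m ∷ʳ′ t with just-injective (≡-trans (≡-sym (last-∷ʳ (c ∷ m))) lastC)
...   | refl = path⇒linked (pathEdge-adj {G = G} λ k → adjC (there (consec-++⁺ (t ∷ []) k))) m-avoids
                 (interior a∈C aA) (interior b∈C bA)
  where
  m-avoids : All (Avoids c t) m
  m-avoids = All.tabulate λ z∈m → (λ { refl → Unique[x∷xs]⇒x∉xs uC (∈-++⁺ˡ z∈m) })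
                                 , (λ { refl → Unique-∷ʳ⇒∉ m (AllPairs.tail uC) z∈m })
  interior : z ∈ c ∷ m ∷ʳ t → Avoids c t z → z ∈ m
  interior (here refl) (z≢c , _) = ⊥-elim (z≢c refl)
  interior (there z∈)  (_ , z≢t) = Sum.[ id , (λ { (here refl) → ⊥-elim (z≢t refl) }) ] (∈-++⁻ m z∈)

path-meets-or-linked : IsPathFromTo G a b l → x ∈ l ⊎ y ∈ l ⊎ Linked G x y a b
path-meets-or-linked {G} {l = l} {x} {y} ((_ , _ , _ , adj) , first , final) with x ∈? l | y ∈? l
... | yes x∈l | _        = inj₁ x∈l
... | no _    | yes y∈l  = inj₂ (inj₁ y∈l)
... | no x∉l  | no y∉l   =
  inj₂ (inj₂ (path⇒linked (pathEdge-adj {G = G} adj) avoids (head-∈ l first) (last-∈ l final)))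
  where
  avoids : All (Avoids x y) l
  avoids = All.tabulate λ z∈l → (λ { refl → x∉l z∈l }) , (λ { refl → y∉l z∈l })

fundamentalCycle-separated : {T : Graph} → Polygonal2Tree G → IsSpanningTree G T →
  IsFundamentalCycle G T x y C →
  IsInducedCycle (Enc G C) C₁ → x ∈ C₁ → y ∈ C₁ →
  IsInducedCycle G C₂ → x ∈ C₂ → y ∈ C₂ → ¬ (C₁ ⊆ C₂ × C₂ ⊆ C₁) →
  a ∈ C → Avoids x y a → b ∈ C₂ → Avoids x y b → ¬ Linked G x y a b
fundamentalCycle-separated {G} {x} {y} {C} {T = T} tree (vertices , T⇒G , _ , _)
  (xy , _ , path@((_ , _ , C⊆T , _) , _)) ic₁ x₁ y₁ ic₂ x₂ y₂ C₁≉C₂ a∈C aA b∈C₂ bA walk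
  with induced-inducedCycle {G = G} C (λ z∈C → to (vertices _) (All.lookup C⊆T z∈C)) ic₁
... | ic₁G , C₁⊆C with cycle-avoiding-vertex {G = G} {y = y} (proj₁ ic₁G) x₁
... | w , w∈C₁ , wA = C₁≉C₂ (polygonal2Tree-coincide tree x≢y ic₁G ic₂ x₁ y₁ x₂ y₂ w∈C₁ wA b∈C₂ bA
        (linked-mono {G = T} T⇒G (path-interior-linked path (C₁⊆C w∈C₁) wA a∈C aA) ◅◅ walk))
  where
  x≢y : ¬ x ≡ y
  x≢y refl = irrefl G xy

lemma13 : (G T : Graph) → Polygonal2Tree G → IsSpanningTree G T →
    (x y : ℕ) → (C C₁ C₂ : List ℕ) →
    IsFundamentalCycle G T x y C →
    IsInducedCycle (Enc G C) C₁ → CycEdge C₁ x y →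
    IsInducedCycle G C₂ → CycEdge C₂ x y →
    ¬ (∀ z → (z ∈ C₁) ⇔ (z ∈ C₂)) →
    (∀ z → (z ∈ C × z ∈ C₂) ⇔ (z ≡ x ⊎ z ≡ y))
    × (∀ u v → u ∈ C → ¬ u ≡ x → ¬ u ≡ y →
         v ∈ C₂ → ¬ v ≡ x → ¬ v ≡ y →
         ∀ ps → IsPathFromTo G u v ps → x ∈ ps ⊎ y ∈ ps)
lemma13 G T tree spanning x y C C₁ C₂ fundamental@(_ , _ , _ , first , final)
  ic₁ e₁ ic₂ e₂ C₁≉C₂ =
  (λ z → mk⇔ shared λ { (inj₁ refl) → head-∈ C first , cycEdge-∈ˡ e₂
                      ; (inj₂ refl) → last-∈ C final , cycEdge-∈ʳ e₂ })
  , λ u v u∈C u≢x u≢y v∈C₂ v≢x v≢y ps path →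
      Sum.map₂ (Sum.[ id , (λ walk → ⊥-elim (separated u∈C (u≢x , u≢y) v∈C₂ (v≢x , v≢y) walk)) ])
        (path-meets-or-linked path)
  where
  separated : a ∈ C → Avoids x y a → b ∈ C₂ → Avoids x y b → ¬ Linked G x y a b
  separated = fundamentalCycle-separated {G = G} {T = T} tree spanning fundamental
    ic₁ (cycEdge-∈ˡ e₁) (cycEdge-∈ʳ e₁) ic₂ (cycEdge-∈ˡ e₂) (cycEdge-∈ʳ e₂)
    λ (C₁⊆C₂ , C₂⊆C₁) → C₁≉C₂ λ _ → mk⇔ C₁⊆C₂ C₂⊆C₁
  shared : z ∈ C × z ∈ C₂ → z ≡ x ⊎ z ≡ y
  shared {z} (z∈C , z∈C₂) with z ≟ x | z ≟ y
  ... | yes z≡x | _       = inj₁ z≡x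
  ... | no _    | yes z≡y = inj₂ z≡y
  ... | no z≢x  | no z≢y  = ⊥-elim (separated z∈C (z≢x , z≢y) z∈C₂ (z≢x , z≢y) ε)
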